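{- Let $G$ be a graph with vertex weights $\mathsf{w}:V(G)\to\mathbb{Q}$, $\mathsf{opt}\in\{\min,\max\}$, $(T,\delta)$ a rooted layout of $G$, $x$ a node of $T$, $R'\subseteq\overline{V_x}$ and $\mathcal{A}\subseteq 2^{V_x}$. For all $\mathcal{D}\subseteq\mathcal{A}$, if $\mathcal{A}$ is $R'$-consistent and $\mathcal{D}$ $(x,R')$-represents $\mathcal{A}$, then $\mathcal{D}$ $(x,R')^{\mathsf{acy}}$-represents $\mathcal{A}$.
   Context: A rooted layout of $G$ is a pair $(T,\delta)$ with $T$ a rooted binary tree and $\delta$ a bijection between $V(G)$ and the leaves of $T$; $V_x$ is the set of vertices $v$ such that the root-to-$\delta(v)$ path contains $x$, and $\overline{V_x}=V(G)\setminus V_x$. For $S\subseteq V(G)$ and $d\in\mathbb{N}^+$, $X\equiv^d_S Y$ means $\min(d,|X\cap N(u)|)=\min(d,|Y\cap N(u)|)$ for all $u\in V(G)\setminus S$. With $\mathsf{w}(X)=\sum_{v\in X}\mathsf{w}(v)$, $\min\emptyset=+\infty$, $\max\emptyset=-\infty$: $\mathsf{best}(\mathcal{C},Y):=\mathsf{opt}\{\mathsf{w}(X):X\in\mathcal{C},\ G[X\cup Y]\text{ connected}\}$ and $\mathsf{best}^{\mathsf{acy}}(\mathcal{C},Y):=\mathsf{opt}\{\mathsf{w}(X):X\in\mathcal{C},\ G[X\cup Y]\text{ is a tree}\}$. $\mathcal{D}$ $(x,R')$-represents $\mathcal{A}$ if $\mathsf{best}(\mathcal{A},Y)=\mathsf{best}(\mathcal{D},Y)$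 for all $Y\subseteq\overline{V_x}$ with $Y\equiv^1_{\overline{V_x}}R'$; $\mathcal{D}$ $(x,R')^{\mathsf{acy}}$-represents $\mathcal{A}$ if $\mathsf{best}^{\mathsf{acy}}(\mathcal{A},Y)=\mathsf{best}^{\mathsf{acy}}(\mathcal{D},Y)$ for all $Y\subseteq\overline{V_x}$ with $Y\equiv^2_{\overline{V_x}}R'$. $\mathcal{A}$ is $R'$-consistent if for each $Y\subseteq\overline{V_x}$ with $Y\equiv^2_{\overline{V_x}}R'$: if some $W\in\mathcal{A}$ has $G[W\cup Y]$ a tree, then for every $X\in\mathcal{A}$, $G[X\cup Y]$ is either a tree or not connected. -}

module Defs where

open import Data.Nat using (ℕ; zero; suc; _≤_) renaming (_⊓_ to minℕ)
open import Data.Bool using (Bool; true; false; if_then_else_)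
open import Data.Fin using (Fin; zero; suc)
open import Data.Fin.Subset using (Subset; _∈_; _∉_; _⊆_; ∁; _∩_; _∪_; ∣_∣)
open import Data.Vec using (Vec; []; _∷_; tabulate)
open import Data.List using (List; []; _∷_; _++_; length)
import Data.List.Membership.Propositional as LM
open import Data.List.Relation.Unary.All using (All)
open import Data.List.Relation.Unary.Unique.Propositional using (Unique)
open import Data.List.Relation.Unary.Linked using (Linked)
open import Data.Rational using (ℚ; 0ℚ; _+_) renaming (_≤_ to _≤ℚ_)
open import Data.Product using (Σ; _×_; ∃)
open import Data.Sum using (_⊎_)
open import Data.Empty using (⊥)
open import Relation.Nullary using (¬_)
open import Relation.Binary.PropositionalEquality using (_≡_)
open import Function.Bundles using (_⇔_)

record Graph (n : ℕ) : Set where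
  field
    adj   : Fin n → Fin n → Bool
    sym   : ∀ u v → adj u v ≡ adj v u
    irrefl : ∀ v → adj v v ≡ false

module _ {n : ℕ} (G : Graph n) where
  open Graph G

  Edge : Fin n → Fin n → Set
  Edge u v = adj u v ≡ true

  N : Fin n → Subset n
  N u = tabulate (adj u)

  d-equiv : ℕ → Subset n → Subset n → Subset n → Set
  d-equiv d S X Y = ∀ u → u ∉ S →
    minℕ d ∣ X ∩ N u ∣ ≡ minℕ d ∣ Y ∩ N u ∣

  data Reach (Z : Subset n) : Fin n → Fin n → Set where
    here : ∀ {u} → u ∈ Z → Reach Z u u
    step : ∀ {u w v} → u ∈ Z → Edge u w → Reach Z w v → Reach Z u v

  Connected : Subset n → Set
  Connected Z = ∀ u v → u ∈ Z → v ∈ Z → Reach Z u v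

  Cycle : Subset n → Set
  Cycle Z = Σ (Fin n) λ v → Σ (List (Fin n)) λ rest →
    (2 ≤ length rest) × Unique (v ∷ rest) × All (_∈ Z) (v ∷ rest) ×
    Linked Edge (v ∷ rest ++ v ∷ [])

  Acyclic : Subset n → Set
  Acyclic Z = ¬ Cycle Z

  IsTree : Subset n → Set
  IsTree Z = Connected Z × Acyclic Z

data BTree (n : ℕ) : Set where
  leaf : Fin n → BTree n
  node : BTree n → BTree n → BTree n

data Node {n : ℕ} : BTree n → Set where
  root  : ∀ {t} → Node t
  left  : ∀ {l r} → Node l → Node (node l r)
  right : ∀ {l r} → Node r → Node (node l r)

subtree : ∀ {n} (t : BTree n) → Node t → BTree n
subtree t root = t
subtree (node l r) (left x) = subtree l x
subtree (node l r) (right x) = subtree r x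

leaves : ∀ {n} → BTree n → List (Fin n)
leaves (leaf v) = v ∷ []
leaves (node l r) = leaves l ++ leaves r

-- (T, δ): the leaf labels give a bijection between V(G) and the leaves
record Layout (n : ℕ) : Set where
  field
    tree   : BTree n
    unique : Unique (leaves tree)
    onto   : ∀ v → v LM.∈ leaves tree

V : ∀ {n} (L : Layout n) → Node (Layout.tree L) → Subset n
V L x = tabulate λ v → inLeaves v (leaves (subtree (Layout.tree L) x))
  where
  inLeaves : ∀ {n} → Fin n → List (Fin n) → Bool
  inLeaves v [] = false
  inLeaves v (u ∷ us) with Data.Fin._≟_ v u
  ... | Relation.Nullary.yes _ = true
  ... | Relation.Nullary.no _ = inLeaves v us

wsum : ∀ {n} → (Fin n → ℚ) → Subset n → ℚ
wsum w [] = 0ℚ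
wsum w (b ∷ X) = (if b then w zero else 0ℚ) + wsum (λ i → w (suc i)) X

data Opt : Set where
  min max : Opt

data ℚ∞ : Set where
  -∞ : ℚ∞
  fin : ℚ → ℚ∞
  +∞ : ℚ∞

-- IsOpt opt w C P v : v = opt { w(X) : X ∈ C, P X }  (min ∅ = +∞, max ∅ = -∞)
IsOpt : ∀ {n} → Opt → (Fin n → ℚ) → List (Subset n) → (Subset n → Set) → ℚ∞ → Set
IsOpt {n} min w C P v =
  (v ≡ +∞ × (∀ X → X LM.∈ C → ¬ P X)) ⊎
  (Σ (Subset n) λ X → X LM.∈ C × P X × v ≡ fin (wsum w X) ×
     (∀ X' → X' LM.∈ C → P X' → wsum w X ≤ℚ wsum w X'))
IsOpt {n} max w C P v =
  (v ≡ -∞ × (∀ X → X LM.∈ C → ¬ P X)) ⊎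
  (Σ (Subset n) λ X → X LM.∈ C × P X × v ≡ fin (wsum w X) ×
     (∀ X' → X' LM.∈ C → P X' → wsum w X' ≤ℚ wsum w X))

module _ {n : ℕ} (G : Graph n) (w : Fin n → ℚ) (opt : Opt) where

  Best : List (Subset n) → Subset n → ℚ∞ → Set
  Best C Y = IsOpt opt w C (λ X → Connected G (X ∪ Y))

  BestAcy : List (Subset n) → Subset n → ℚ∞ → Set
  BestAcy C Y = IsOpt opt w C (λ X → IsTree G (X ∪ Y))

  module _ (L : Layout n) (x : Node (Layout.tree L)) where

    Vx̄ : Subset n
    Vx̄ = ∁ (V L x)

    Represents : Subset n → List (Subset n) → List (Subset n) → Set
    Represents R' D A = ∀ Y → Y ⊆ Vx̄ → d-equiv G 1 Vx̄ Y R' →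
      ∀ v → Best A Y v ⇔ Best D Y v

    RepresentsAcy : Subset n → List (Subset n) → List (Subset n) → Set
    RepresentsAcy R' D A = ∀ Y → Y ⊆ Vx̄ → d-equiv G 2 Vx̄ Y R' →
      ∀ v → BestAcy A Y v ⇔ BestAcy D Y v

    Consistent : Subset n → List (Subset n) → Set
    Consistent R' A = ∀ Y → Y ⊆ Vx̄ → d-equiv G 2 Vx̄ Y R' →
      (Σ (Subset n) λ W → W LM.∈ A × IsTree G (W ∪ Y)) →
      ∀ X → X LM.∈ A → IsTree G (X ∪ Y) ⊎ ¬ Connected G (X ∪ Y)

module Submission where

-- Write P X for "G[X ∪ Y] is connected" and Q X for "G[X ∪ Y]
-- is a tree", so Q implies P.  If some member of A satisfies Q, consistency
-- says that on A (hence on D ⊆ A) the predicates P and Q coincide, and then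
--   best^acy(A,Y) = best(A,Y) = best(D,Y) = best^acy(D,Y),
-- the middle step being representation (a 2-equivalent Y is 1-equivalent).
-- If no member of A satisfies Q, none of D does either, and both optima are
-- the empty value (+∞ for min, -∞ for max).  Since Q is not decidable here,
-- the case split is made on the optimum that is given: a finite optimum
-- supplies a witness, and an empty optimum over D rules out any witness in
-- A by running the first case backwards.

open import Defs
open import Data.Nat using (ℕ; _≤_; s≤s; z≤n) renaming (_⊓_ to minℕ)
open import Data.Nat.Properties using (⊓-assoc; m≤n⇒m⊓n≡m)
open import Data.Fin using (Fin)
open import Data.Fin.Subset using (Subset; _⊆_; _∪_; _∩_; ∣_∣)
open import Data.List using (List)
open import Data.List.Relation.Unary.All using (All)
open import Data.Rational using (ℚ)
import Data.List.Membership.Propositional as LM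
open import Data.Product using (Σ; _×_; _,_; proj₁)
open import Data.Sum using (_⊎_; inj₁; inj₂)
open import Data.Empty using (⊥-elim)
open import Relation.Nullary using (¬_)
open import Relation.Binary.PropositionalEquality
  using (_≡_; refl; sym; cong; subst; module ≡-Reasoning)
open import Function.Bundles using (_⇔_; mk⇔; Equivalence)
import Function.Properties.Equivalence as ⇔

emptyValue : Opt → ℚ∞
emptyValue min = +∞
emptyValue max = -∞

Witnessed : ∀ {n} → List (Subset n) → (Subset n → Set) → Set
Witnessed {n} C P = Σ (Subset n) λ X → X LM.∈ C × P X

private variable opt : Opt

module _ {n : ℕ} (w : Fin n → ℚ) where

  IsOpt-cases : ∀ {C P v} → IsOpt opt w C P v →
    (v ≡ emptyValue opt × ¬ Witnessed C P) ⊎ Witnessed C P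
  IsOpt-cases {opt = min} (inj₁ (v≡e , none)) =
    inj₁ (v≡e , λ (X , X∈ , p) → none X X∈ p)
  IsOpt-cases {opt = max} (inj₁ (v≡e , none)) =
    inj₁ (v≡e , λ (X , X∈ , p) → none X X∈ p)
  IsOpt-cases {opt = min} (inj₂ (X , X∈ , p , _)) = inj₂ (X , X∈ , p)
  IsOpt-cases {opt = max} (inj₂ (X , X∈ , p , _)) = inj₂ (X , X∈ , p)

  IsOpt-empty : ∀ {C P} → ¬ Witnessed C P → IsOpt opt w C P (emptyValue opt)
  IsOpt-empty {opt = min} none = inj₁ (refl , λ X X∈ p → none (X , X∈ , p))
  IsOpt-empty {opt = max} none = inj₁ (refl , λ X X∈ p → none (X , X∈ , p))

  -- Conversely, the empty value is the optimum only if nothing is feasible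
  -- (it is never the weight of a set).
  IsOpt-empty⁻¹ : ∀ {C P} → IsOpt opt w C P (emptyValue opt) →
    ¬ Witnessed C P
  IsOpt-empty⁻¹ {opt = min} (inj₁ (_ , none)) (X , X∈ , p) = none X X∈ p
  IsOpt-empty⁻¹ {opt = max} (inj₁ (_ , none)) (X , X∈ , p) = none X X∈ p

  IsOpt-transport : ∀ {C P Q v} → (∀ X → X LM.∈ C → P X ⇔ Q X) →
    IsOpt opt w C P v → IsOpt opt w C Q v
  IsOpt-transport {opt = min} P⇔Q (inj₁ (v≡e , none)) =
    inj₁ (v≡e , λ X X∈ q → none X X∈ (Equivalence.from (P⇔Q X X∈) q))
  IsOpt-transport {opt = max} P⇔Q (inj₁ (v≡e , none)) =
    inj₁ (v≡e , λ X X∈ q → none X X∈ (Equivalence.from (P⇔Q X X∈) q))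
  IsOpt-transport {opt = min} P⇔Q (inj₂ (X , X∈ , p , v≡wX , best)) =
    inj₂ (X , X∈ , Equivalence.to (P⇔Q X X∈) p , v≡wX ,
          λ X' X'∈ q → best X' X'∈ (Equivalence.from (P⇔Q X' X'∈) q))
  IsOpt-transport {opt = max} P⇔Q (inj₂ (X , X∈ , p , v≡wX , best)) =
    inj₂ (X , X∈ , Equivalence.to (P⇔Q X X∈) p , v≡wX ,
          λ X' X'∈ q → best X' X'∈ (Equivalence.from (P⇔Q X' X'∈) q))

  IsOpt-cong : ∀ {C P Q v} → (∀ X → X LM.∈ C → P X ⇔ Q X) →
    IsOpt opt w C P v ⇔ IsOpt opt w C Q v
  IsOpt-cong P⇔Q =
    mk⇔ (IsOpt-transport P⇔Q) (IsOpt-transport λ X X∈ → ⇔.sym (P⇔Q X X∈))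

  represents-refinement : (opt : Opt) (A D : List (Subset n)) (P Q : Subset n → Set) →
    (∀ X → Q X → P X) →
    (∀ X → X LM.∈ D → X LM.∈ A) →
    (Witnessed A Q → ∀ X → X LM.∈ A → Q X ⊎ ¬ P X) →
    (∀ v → IsOpt opt w A P v ⇔ IsOpt opt w D P v) →
    ∀ v → IsOpt opt w A Q v ⇔ IsOpt opt w D Q v
  represents-refinement opt A D P Q Q⇒P D⊆A consistent represents v =
    mk⇔ forward backward
    where
    agree : Witnessed A Q → ∀ X → X LM.∈ A → P X ⇔ Q X
    agree wit X X∈ with consistent wit X X∈
    ... | inj₁ q  = mk⇔ (λ _ → q) (Q⇒P X)
    ... | inj₂ ¬p = mk⇔ (λ p → ⊥-elim (¬p p)) (Q⇒P X)

    chain : Witnessed A Q → ∀ u → IsOpt opt w A Q u ⇔ IsOpt opt w D Q u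
    chain wit u =
      ⇔.trans (IsOpt-cong λ X X∈ → ⇔.sym (agree wit X X∈))
        (⇔.trans (represents u)
          (IsOpt-cong λ X X∈ → agree wit X (D⊆A X X∈)))

    restrict : ¬ Witnessed A Q → ¬ Witnessed D Q
    restrict none (X , X∈ , q) = none (X , D⊆A X X∈ , q)

    forward : IsOpt opt w A Q v → IsOpt opt w D Q v
    forward optA with IsOpt-cases optA
    ... | inj₁ (v≡e , none) = subst (IsOpt opt w D Q) (sym v≡e)
                                (IsOpt-empty (restrict none))
    ... | inj₂ wit = Equivalence.to (chain wit v) optA

    no-witness : ¬ Witnessed D Q → ¬ Witnessed A Q
    no-witness noneD wit = IsOpt-empty⁻¹
      (Equivalence.from (chain wit (emptyValue opt)) (IsOpt-empty noneD)) wit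

    backward : IsOpt opt w D Q v → IsOpt opt w A Q v
    backward optD with IsOpt-cases optD
    ... | inj₁ (v≡e , noneD) = subst (IsOpt opt w A Q) (sym v≡e)
                                 (IsOpt-empty (no-witness noneD))
    ... | inj₂ (X , X∈ , q) = Equivalence.from (chain (X , D⊆A X X∈ , q) v) optD

d-equiv-weaken : ∀ {n} (G : Graph n) {d d' : ℕ} {S X Y : Subset n} → d ≤ d' →
  d-equiv G d' S X Y → d-equiv G d S X Y
d-equiv-weaken G {d} {d'} {X = X} {Y} d≤d' equiv u u∉S = begin
  minℕ d ∣X∣            ≡⟨ cong (λ k → minℕ k ∣X∣) (sym (m≤n⇒m⊓n≡m d≤d')) ⟩
  minℕ (minℕ d d') ∣X∣  ≡⟨ ⊓-assoc d d' ∣X∣ ⟩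
  minℕ d (minℕ d' ∣X∣)  ≡⟨ cong (minℕ d) (equiv u u∉S) ⟩
  minℕ d (minℕ d' ∣Y∣)  ≡⟨ sym (⊓-assoc d d' ∣Y∣) ⟩
  minℕ (minℕ d d') ∣Y∣  ≡⟨ cong (λ k → minℕ k ∣Y∣) (m≤n⇒m⊓n≡m d≤d') ⟩
  minℕ d ∣Y∣            ∎
  where
  open ≡-Reasoning
  ∣X∣ = ∣ X ∩ N G u ∣
  ∣Y∣ = ∣ Y ∩ N G u ∣

lemma6p8 : {n : ℕ} (G : Graph n) (w : Fin n → ℚ) (opt : Opt)
    (L : Layout n) (x : Node (Layout.tree L))
    (R' : Subset n) → R' ⊆ Vx̄ G w opt L x →
    (A : List (Subset n)) → All (_⊆ V L x) A →
    (D : List (Subset n)) → (∀ X → X LM.∈ D → X LM.∈ A) →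
    Consistent G w opt L x R' A →
    Represents G w opt L x R' D A →
    RepresentsAcy G w opt L x R' D A
lemma6p8 G w opt L x R' _ A _ D D⊆A consistent represents Y Y⊆ Y≡²R' =
  represents-refinement w opt A D
    (λ X → Connected G (X ∪ Y)) (λ X → IsTree G (X ∪ Y))
    (λ X → proj₁) D⊆A
    (consistent Y Y⊆ Y≡²R')
    (represents Y Y⊆ (d-equiv-weaken G {X = Y} {R'} (s≤s z≤n) Y≡²R'))
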